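{- For any $B>0$, the strategy $\mathcal{S}_B^\star(f,c,\varepsilon)$ has expected cost exactly $\Delta_c(\mathcal{S}_B^\star)=\min\big(B,\sum_{i=1}^n c_i\big)$.
   Context: Here $f:\{0,1\}^n\to\{\pm1\}$, $c\in\mathbb{N}^n$, $\varepsilon\in(0,\tfrac12)$. $\Delta_c(\mathcal{S})$ is the expected total cost (cost $c_i$ for each query of coordinate $i$) of strategy $\mathcal{S}$ on a uniform random input, over the input and the strategy's randomness. $\mathrm{Inf}_i(g)=\Pr[g(\mathbf{x})\ne g(\mathbf{x}^{\oplus i})]$ ($\mathbf{x}^{\oplus i}$ = $\mathbf{x}$ with coordinate $i$ flipped); $f_{x_i=b}$ is the restriction of $f$ fixing $x_i=b$. The strategy $\mathcal{S}_B^\star(f,c,\varepsilon)$ on unknown input $\underline{x}$: initialize counter $=0$; while counter $<B$: let $i$ maximize $\mathrm{Inf}_i(f)/c_i$ for the current $f$; if counter $+c_i\ge B$, then with probability $(B-\text{counter})/c_i$ query $\underline{x}_i$ and output $\mathrm{sign}(\mathbb{E}[f_{x_i=\underline{x}_i}])$, and with probability $1-(B-\text{counter})/c_i$ output $\mathrm{sign}(\mathbb{E}[f])$ (without querying); otherwise query $\underline{x}_i$, set $f=f_{x_i=\underline{x}_i}$, and add $c_i$ to the counter.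
   Formalization: The parameters B and ε range over the rationals. -}

module Defs where

open import Data.Bool using (Bool; true; false; not; if_then_else_)
open import Data.Nat as ℕ using (ℕ; zero; suc)
open import Data.Fin using (Fin; zero; suc; _≟_)
open import Data.Maybe using (Maybe; just; nothing)
open import Data.Product using (_×_)
open import Data.List using (map; allFin)
open import Data.Nat.ListAction using (sum)
open import Data.Integer using (+_)
open import Data.Rational using (ℚ; _+_; _*_; _-_; _/_; _≤_; _<_; ½; 0ℚ; 1ℚ)
open import Data.Rational.Properties using (_≤?_; _<?_)
open import Relation.Nullary using (yes; no; ¬_)
open import Relation.Binary.PropositionalEquality using (_≡_)

Cube : ℕ → Set
Cube n = Fin n → Bool

data PM : Set where
  pos neg : PM

PMtoℚ : PM → ℚ
PMtoℚ pos = 1ℚ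
PMtoℚ neg = 0ℚ - 1ℚ

_≠PM_ : PM → PM → Bool
pos ≠PM pos = false
neg ≠PM neg = false
pos ≠PM neg = true
neg ≠PM pos = true

ℕtoℚ : ℕ → ℚ
ℕtoℚ k = + k / 1

cons : ∀ {n} → Bool → Cube n → Cube (suc n)
cons b x zero = b
cons b x (suc i) = x i

𝔼 : (n : ℕ) → (Cube n → ℚ) → ℚ
𝔼 zero g = g (λ ())
𝔼 (suc n) g = ½ * (𝔼 n (λ x → g (cons false x)) + 𝔼 n (λ x → g (cons true x)))

flipAt : ∀ {n} → Fin n → Cube n → Cube n
flipAt i x j with j ≟ i
... | yes _ = not (x j)
... | no _ = x j

-- Partial assignments (restrictions): nothing = coordinate still free.
Partial : ℕ → Set
Partial n = Fin n → Maybe Bool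

Free : ∀ {n} → Partial n → Fin n → Set
Free ρ i = ρ i ≡ nothing

merge : ∀ {n} → Partial n → Cube n → Cube n
merge ρ x j with ρ j
... | just b = b
... | nothing = x j

setAt : ∀ {n} → Partial n → Fin n → Bool → Partial n
setAt ρ i b j with j ≟ i
... | yes _ = just b
... | no _ = ρ j

restrict : ∀ {n} → (Cube n → PM) → Partial n → Cube n → PM
restrict f ρ x = f (merge ρ x)

Inf : ∀ {n} → (Cube n → PM) → Fin n → ℚ
Inf {n} g i = 𝔼 n (λ x → if g x ≠PM g (flipAt i x) then 1ℚ else 0ℚ)

-- sign(E[g]) (with sign(0) = +1; irrelevant for the cost)
signE : ∀ {n} → (Cube n → PM) → PM
signE {n} g with 0ℚ ≤? 𝔼 n (λ x → PMtoℚ (g x))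
... | yes _ = pos
... | no _ = neg

data Strategy (n : ℕ) : Set where
  output : PM → Strategy n
  query  : Fin n → (Bool → Strategy n) → Strategy n
  -- coin p S T : with probability p continue with S, otherwise with T
  coin   : ℚ → Strategy n → Strategy n → Strategy n

costOn : ∀ {n} → (Fin n → ℕ) → Strategy n → Cube n → ℚ
costOn c (output _) x = 0ℚ
costOn c (query i k) x = ℕtoℚ (c i) + costOn c (k (x i)) x
costOn c (coin p S T) x = p * costOn c S x + (1ℚ - p) * costOn c T x

Δ : ∀ {n} → (Fin n → ℕ) → Strategy n → ℚ
Δ {n} c S = 𝔼 n (costOn c S)

-- Inf_i(g)/c_i ≤ Inf_j(g)/c_j, written with cleared denominators.
RatioLe : ∀ {n} → (Cube n → PM) → (Fin n → ℕ) → Fin n → Fin n → Set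
RatioLe g c i j = Inf g i * ℕtoℚ (c j) ≤ Inf g j * ℕtoℚ (c i)

IsArgmaxSelector : ∀ {n} → (Cube n → PM) → (Fin n → ℕ) → (Partial n → Maybe (Fin n)) → Set
IsArgmaxSelector {n} f c sel = (ρ : Partial n) →
  ((sel ρ ≡ nothing → (i : Fin n) → ¬ Free ρ i) ×
   ((i : Fin n) → sel ρ ≡ just i →
      Free ρ i × ((j : Fin n) → Free ρ j → RatioLe (restrict f ρ) c j i)))

-- (B - counter)/c_i ; the c_i = 0 case never occurs when this is used.
stopProb : ℚ → ℕ → ℕ → ℚ
stopProb B counter zero = 1ℚ
stopProb B counter (suc m) = (B - ℕtoℚ counter) * (+ 1 / suc m)

-- The loop of S⋆_B, with fuel (at most n queries can ever be made).
loop : ∀ {n} → (Cube n → PM) → (Fin n → ℕ) → ℚ → (Partial n → Maybe (Fin n)) →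
       ℕ → ℕ → Partial n → Strategy n
loop f c B sel zero counter ρ = output (signE (restrict f ρ))
loop f c B sel (suc fuel) counter ρ with ℕtoℚ counter <? B
... | no _ = output (signE (restrict f ρ))
... | yes _ with sel ρ
...   | nothing = output (signE (restrict f ρ))
...   | just i with B ≤? ℕtoℚ counter + ℕtoℚ (c i)
...     | yes _ = coin (stopProb B counter (c i))
                       (query i (λ b → output (signE (restrict f (setAt ρ i b)))))
                       (output (signE (restrict f ρ)))
...     | no _ = query i (λ b → loop f c B sel fuel (counter ℕ.+ c i) (setAt ρ i b))

-- S⋆_B(f, c, ε) (ε does not influence the strategy's behaviour).
Sstar : ∀ {n} → (Cube n → PM) → (Fin n → ℕ) → ℚ → ℚ → (Partial n → Maybe (Fin n)) → Strategy n
Sstar {n} f c ε B sel = loop f c B sel n 0 (λ _ → nothing)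

totalCost : ∀ {n} → (Fin n → ℕ) → ℕ
totalCost {n} c = sum (map c (allFin n))

{-# OPTIONS --safe #-}
module Submission where

-- On a fixed input the strategy is deterministic up to its final coin. Queried
-- coordinates become fixed, so the counter C plus the cost of the still-free
-- coordinates is always Σ c. Either every coordinate is queried while C < B, and
-- the cost is Σ c < B, or a last coordinate i with B ≤ C + c_i is queried with
-- probability (B - C)/c_i, and the expected cost is C + (B - C) = B ≤ Σ c. Only
-- freeness of the selected coordinate matters, not that it maximises Inf_i/c_i.

open import Defs
open import Algebra.Bundles using (AbelianGroup)
import Algebra.Properties.Group as GroupProperties
open import Data.Bool using (Bool; true; false)
open import Data.Fin using (Fin; zero; suc; _≟_; punchIn)
open import Data.Fin.Properties using (punchInᵢ≢i)
open import Data.Integer as ℤ using (+_)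
import Data.Integer.Properties as ℤ
open import Data.List using (tabulate)
open import Data.List.Properties using (map-tabulate)
open import Data.Maybe using (Maybe; just; nothing)
open import Data.Nat as ℕ using (ℕ; zero; suc)
import Data.Nat.ListAction as ListAction
import Data.Nat.Properties as ℕ
open import Data.Product using (proj₁; proj₂)
open import Data.Rational using (ℚ; _+_; _*_; _-_; _/_; _≤_; _<_; _⊓_; 0ℚ; 1ℚ; ½; toℚᵘ)
open import Data.Rational.Properties hiding (_≟_)
import Data.Rational.Unnormalised as ℚᵘ
import Data.Rational.Unnormalised.Properties as ℚᵘ
open import Function using (id; _∘_)
open import Relation.Nullary using (yes; no; ¬_; contradiction)
open import Relation.Binary.PropositionalEquality
  using (_≡_; _≢_; refl; sym; trans; cong; cong₂; subst; module ≡-Reasoning)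

open import Algebra.Properties.CommutativeMonoid.Sum ℕ.+-0-commutativeMonoid
  using (sum; sum-remove; sum-cong-≗; sum-replicate-zero)
open GroupProperties (AbelianGroup.group +-0-abelianGroup) using (//-rightDividesˡ)

toℚᵘ-ℕtoℚ : ∀ k → toℚᵘ (ℕtoℚ k) ℚᵘ.≃ ℚᵘ.mkℚᵘ (+ k) 0
toℚᵘ-ℕtoℚ k = toℚᵘ-fromℚᵘ (ℚᵘ.mkℚᵘ (+ k) 0)

mkℚᵘ-+ : ∀ a b → ℚᵘ.mkℚᵘ (+ (a ℕ.+ b)) 0 ℚᵘ.≃ ℚᵘ.mkℚᵘ (+ a) 0 ℚᵘ.+ ℚᵘ.mkℚᵘ (+ b) 0
mkℚᵘ-+ a b = ℚᵘ.*≡* (begin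
  + (a ℕ.+ b) ℤ.* + 1                   ≡⟨ ℤ.*-identityʳ _ ⟩
  + a ℤ.+ + b                           ≡⟨ cong₂ ℤ._+_ (ℤ.*-identityʳ (+ a)) (ℤ.*-identityʳ (+ b)) ⟨
  + a ℤ.* + 1 ℤ.+ + b ℤ.* + 1           ≡⟨ ℤ.*-identityʳ _ ⟨
  (+ a ℤ.* + 1 ℤ.+ + b ℤ.* + 1) ℤ.* + 1 ∎)
  where open ≡-Reasoning

ℕtoℚ-+ : ∀ a b → ℕtoℚ (a ℕ.+ b) ≡ ℕtoℚ a + ℕtoℚ b
ℕtoℚ-+ a b = toℚᵘ-injective (begin-equality
  toℚᵘ (ℕtoℚ (a ℕ.+ b))                    ≃⟨ toℚᵘ-ℕtoℚ (a ℕ.+ b) ⟩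
  ℚᵘ.mkℚᵘ (+ (a ℕ.+ b)) 0                  ≃⟨ mkℚᵘ-+ a b ⟩
  ℚᵘ.mkℚᵘ (+ a) 0 ℚᵘ.+ ℚᵘ.mkℚᵘ (+ b) 0      ≃⟨ ℚᵘ.+-cong (toℚᵘ-ℕtoℚ a) (toℚᵘ-ℕtoℚ b) ⟨
  toℚᵘ (ℕtoℚ a) ℚᵘ.+ toℚᵘ (ℕtoℚ b)          ≃⟨ toℚᵘ-homo-+ (ℕtoℚ a) (ℕtoℚ b) ⟨
  toℚᵘ (ℕtoℚ a + ℕtoℚ b)                   ∎)
  where open ℚᵘ.≤-Reasoning

ℕtoℚ-mono-≤ : ∀ {a b} → a ℕ.≤ b → ℕtoℚ a ≤ ℕtoℚ b
ℕtoℚ-mono-≤ {a} {b} a≤b = toℚᵘ-cancel-≤ (begin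
  toℚᵘ (ℕtoℚ a)        ≃⟨ toℚᵘ-ℕtoℚ a ⟩
  ℚᵘ.mkℚᵘ (+ a) 0      ≤⟨ ℚᵘ.*≤* (ℤ.*-monoʳ-≤-nonNeg (+ 1) (ℤ.+≤+ a≤b)) ⟩
  ℚᵘ.mkℚᵘ (+ b) 0      ≃⟨ toℚᵘ-ℕtoℚ b ⟨
  toℚᵘ (ℕtoℚ b)        ∎)
  where open ℚᵘ.≤-Reasoning

1/suc*ℕtoℚ-suc : ∀ m → (+ 1 / suc m) * ℕtoℚ (suc m) ≡ 1ℚ
1/suc*ℕtoℚ-suc m = toℚᵘ-injective (begin-equality
  toℚᵘ ((+ 1 / suc m) * ℕtoℚ (suc m))
    ≃⟨ toℚᵘ-homo-* (+ 1 / suc m) (ℕtoℚ (suc m)) ⟩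
  toℚᵘ (+ 1 / suc m) ℚᵘ.* toℚᵘ (ℕtoℚ (suc m))
    ≃⟨ ℚᵘ.*-cong (toℚᵘ-fromℚᵘ (ℚᵘ.mkℚᵘ (+ 1) m)) (toℚᵘ-ℕtoℚ (suc m)) ⟩
  ℚᵘ.1/ sucᵘ ℚᵘ.* sucᵘ
    ≃⟨ ℚᵘ.*-inverseˡ sucᵘ ⟩
  ℚᵘ.1ℚᵘ
    ∎)
  where
  open ℚᵘ.≤-Reasoning
  sucᵘ = ℚᵘ.mkℚᵘ (+ suc m) 0

stopProb-* : ∀ B C m → stopProb B C (suc m) * ℕtoℚ (suc m) ≡ B - ℕtoℚ C
stopProb-* B C m = begin
  (B - ℕtoℚ C) * (+ 1 / suc m) * ℕtoℚ (suc m)   ≡⟨ *-assoc (B - ℕtoℚ C) _ _ ⟩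
  (B - ℕtoℚ C) * ((+ 1 / suc m) * ℕtoℚ (suc m)) ≡⟨ cong ((B - ℕtoℚ C) *_) (1/suc*ℕtoℚ-suc m) ⟩
  (B - ℕtoℚ C) * 1ℚ                            ≡⟨ *-identityʳ _ ⟩
  B - ℕtoℚ C                                   ∎
  where open ≡-Reasoning

stopProb-cost : ∀ {B} C k → ℕtoℚ C < B → B ≤ ℕtoℚ C + ℕtoℚ k →
  ℕtoℚ C + (stopProb B C k * (ℕtoℚ k + 0ℚ) + (1ℚ - stopProb B C k) * 0ℚ) ≡ B
stopProb-cost {B} C zero C<B B≤C+0 =
  contradiction (<-≤-trans C<B (subst (B ≤_) (+-identityʳ (ℕtoℚ C)) B≤C+0)) (<-irrefl refl)
stopProb-cost {B} C (suc m) _ _ = begin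
  ℕtoℚ C + (p * (k + 0ℚ) + (1ℚ - p) * 0ℚ)
    ≡⟨ cong₂ (λ q r → ℕtoℚ C + (p * q + r)) (+-identityʳ k) (*-zeroʳ (1ℚ - p)) ⟩
  ℕtoℚ C + (p * k + 0ℚ)
    ≡⟨ cong (λ q → ℕtoℚ C + q) (trans (+-identityʳ _) (stopProb-* B C m)) ⟩
  ℕtoℚ C + (B - ℕtoℚ C)                   ≡⟨ +-comm (ℕtoℚ C) _ ⟩
  B - ℕtoℚ C + ℕtoℚ C                     ≡⟨ //-rightDividesˡ (ℕtoℚ C) B ⟩
  B                                       ∎
  where
  open ≡-Reasoning
  p = stopProb B C (suc m)
  k = ℕtoℚ (suc m)

𝔼-cong : ∀ n {g h : Cube n → ℚ} → (∀ x → g x ≡ h x) → 𝔼 n g ≡ 𝔼 n h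
𝔼-cong zero g≗h = g≗h _
𝔼-cong (suc n) g≗h =
  cong₂ (λ a b → ½ * (a + b)) (𝔼-cong n (g≗h ∘ cons false)) (𝔼-cong n (g≗h ∘ cons true))

𝔼-const : ∀ n q → 𝔼 n (λ _ → q) ≡ q
𝔼-const zero q = refl
𝔼-const (suc n) q = begin
  ½ * (𝔼 n (λ _ → q) + 𝔼 n (λ _ → q)) ≡⟨ cong (λ a → ½ * (a + a)) (𝔼-const n q) ⟩
  ½ * (q + q)                         ≡⟨ *-distribˡ-+ ½ q q ⟩
  ½ * q + ½ * q                       ≡⟨ *-distribʳ-+ q ½ ½ ⟨
  (½ + ½) * q                         ≡⟨ *-identityˡ q ⟩
  q                                   ∎
  where open ≡-Reasoning

weightIfFree : Maybe Bool → ℕ → ℕ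
weightIfFree nothing  w = w
weightIfFree (just _) w = 0

freeWeight : ∀ {n} → Partial n → (Fin n → ℕ) → ℕ
freeWeight ρ w = sum (λ j → weightIfFree (ρ j) (w j))

numFree : ∀ {n} → Partial n → ℕ
numFree ρ = freeWeight ρ (λ _ → 1)

setAt-≡ : ∀ {n} (ρ : Partial n) i b → setAt ρ i b i ≡ just b
setAt-≡ ρ i b with i ≟ i
... | yes _ = refl
... | no i≢i = contradiction refl i≢i

setAt-≢ : ∀ {n} (ρ : Partial n) {i j} b → j ≢ i → setAt ρ i b j ≡ ρ j
setAt-≢ ρ {i} {j} b j≢i with j ≟ i
... | yes j≡i = contradiction j≡i j≢i
... | no _ = refl

freeWeight-≥ : ∀ {n} {ρ : Partial n} {i} (w : Fin n → ℕ) → Free ρ i → w i ℕ.≤ freeWeight ρ w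
freeWeight-≥ {suc n} {ρ} {i} w free = begin
  w i                         ≡⟨ cong (λ m → weightIfFree m (w i)) free ⟨
  g i                         ≤⟨ ℕ.m≤m+n (g i) _ ⟩
  g i ℕ.+ sum (g ∘ punchIn i) ≡⟨ sum-remove {i = i} g ⟨
  sum g                       ∎
  where
  open ℕ.≤-Reasoning
  g : Fin (suc n) → ℕ
  g j = weightIfFree (ρ j) (w j)

freeWeight-none : ∀ {n} {ρ : Partial n} (w : Fin n → ℕ) → (∀ i → ¬ Free ρ i) → freeWeight ρ w ≡ 0
freeWeight-none {n} {ρ} w none = trans (sum-cong-≗ assigned) (sum-replicate-zero n)
  where
  assigned : ∀ j → weightIfFree (ρ j) (w j) ≡ 0
  assigned j with ρ j in ρj
  ... | nothing = contradiction ρj (none j)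
  ... | just _ = refl

freeWeight-setAt : ∀ {n} {ρ : Partial n} {i} (w : Fin n → ℕ) b → Free ρ i →
  freeWeight ρ w ≡ w i ℕ.+ freeWeight (setAt ρ i b) w
freeWeight-setAt {suc n} {ρ} {i} w b free = begin
  sum g                                  ≡⟨ sum-remove {i = i} g ⟩
  g i ℕ.+ sum (g ∘ punchIn i)            ≡⟨ cong₂ ℕ._+_ gᵢ≡wᵢ (sum-cong-≗ unchanged) ⟩
  w i ℕ.+ sum (h ∘ punchIn i)            ≡⟨ cong (λ z → w i ℕ.+ (z ℕ.+ sum (h ∘ punchIn i))) hᵢ≡0 ⟨
  w i ℕ.+ (h i ℕ.+ sum (h ∘ punchIn i))  ≡⟨ cong (w i ℕ.+_) (sum-remove {i = i} h) ⟨
  w i ℕ.+ sum h                          ∎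
  where
  open ≡-Reasoning
  g h : Fin (suc n) → ℕ
  g j = weightIfFree (ρ j) (w j)
  h j = weightIfFree (setAt ρ i b j) (w j)
  gᵢ≡wᵢ : g i ≡ w i
  gᵢ≡wᵢ = cong (λ m → weightIfFree m (w i)) free
  hᵢ≡0 : h i ≡ 0
  hᵢ≡0 = cong (λ m → weightIfFree m (w i)) (setAt-≡ ρ i b)
  unchanged : ∀ k → g (punchIn i k) ≡ h (punchIn i k)
  unchanged k =
    cong (λ m → weightIfFree m (w (punchIn i k))) (sym (setAt-≢ ρ b (punchInᵢ≢i i k)))

numFree-empty : ∀ n → numFree {n} (λ _ → nothing) ≡ n
numFree-empty zero = refl
numFree-empty (suc n) = cong suc (numFree-empty n)

sum-tabulate : ∀ {n} (w : Fin n → ℕ) → ListAction.sum (tabulate w) ≡ sum w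
sum-tabulate {zero} w = refl
sum-tabulate {suc n} w = cong (w zero ℕ.+_) (sum-tabulate (w ∘ suc))

totalCost≡sum : ∀ {n} (c : Fin n → ℕ) → totalCost c ≡ sum c
totalCost≡sum c = trans (cong ListAction.sum (map-tabulate id c)) (sum-tabulate c)

module _ {n} (f : Cube n → PM) (c : Fin n → ℕ) (B : ℚ) (sel : Partial n → Maybe (Fin n))
         (isSel : IsArgmaxSelector f c sel) (x : Cube n) where

  selected-free : ∀ {ρ i} → sel ρ ≡ just i → Free ρ i
  selected-free {ρ} {i} = proj₁ ∘ proj₂ (isSel ρ) i

  Invariant : ℕ → Partial n → Set
  Invariant C ρ = C ℕ.+ freeWeight ρ c ≡ sum c

  exhausted-cost : ∀ {C ρ} → ℕtoℚ C < B → Invariant C ρ → freeWeight ρ c ≡ 0 →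
    ℕtoℚ C + 0ℚ ≡ B ⊓ ℕtoℚ (sum c)
  exhausted-cost {C} C<B inv none = begin
    ℕtoℚ C + 0ℚ       ≡⟨ +-identityʳ _ ⟩
    ℕtoℚ C            ≡⟨ cong ℕtoℚ C≡total ⟩
    ℕtoℚ (sum c)      ≡⟨ p≥q⇒p⊓q≡q (<⇒≤ (subst (λ t → ℕtoℚ t < B) C≡total C<B)) ⟨
    B ⊓ ℕtoℚ (sum c)  ∎
    where
    open ≡-Reasoning
    C≡total : C ≡ sum c
    C≡total = trans (sym (ℕ.+-identityʳ C)) (trans (cong (C ℕ.+_) (sym none)) inv)

  loop-cost : ∀ fuel C ρ → ℕtoℚ C < B → Invariant C ρ → numFree ρ ℕ.≤ fuel →
    ℕtoℚ C + costOn c (loop f c B sel fuel C ρ) x ≡ B ⊓ ℕtoℚ (sum c)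
  loop-cost zero C ρ C<B inv noFuel =
    exhausted-cost C<B inv (freeWeight-none c λ i free →
      contradiction (ℕ.≤-trans (freeWeight-≥ {ρ = ρ} (λ _ → 1) free) noFuel) λ ())
  loop-cost (suc fuel) C ρ C<B inv fuel≥ with ℕtoℚ C <? B
  ... | no C≮B = contradiction C<B C≮B
  ... | yes _ with sel ρ in selρ
  ...   | nothing = exhausted-cost C<B inv (freeWeight-none c (proj₁ (isSel ρ) selρ))
  ...   | just i with B ≤? ℕtoℚ C + ℕtoℚ (c i)
  ...     | yes B≤C+cᵢ = trans (stopProb-cost C (c i) C<B B≤C+cᵢ) (sym (p≤q⇒p⊓q≡p B≤total))
    where
    C+cᵢ≤total : C ℕ.+ c i ℕ.≤ sum c
    C+cᵢ≤total = subst (C ℕ.+ c i ℕ.≤_) inv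
      (ℕ.+-monoʳ-≤ C (freeWeight-≥ {ρ = ρ} c (selected-free selρ)))
    B≤total : B ≤ ℕtoℚ (sum c)
    B≤total = ≤-trans B≤C+cᵢ
      (subst (_≤ ℕtoℚ (sum c)) (ℕtoℚ-+ C (c i)) (ℕtoℚ-mono-≤ C+cᵢ≤total))
  ...     | no B≰C+cᵢ = begin
    ℕtoℚ C + (ℕtoℚ (c i) + rest)   ≡⟨ +-assoc (ℕtoℚ C) _ _ ⟨
    ℕtoℚ C + ℕtoℚ (c i) + rest     ≡⟨ cong (_+ rest) (ℕtoℚ-+ C (c i)) ⟨
    ℕtoℚ (C ℕ.+ c i) + rest        ≡⟨ loop-cost fuel (C ℕ.+ c i) ρ′ C+cᵢ<B inv′ fuel≥′ ⟩
    B ⊓ ℕtoℚ (sum c)               ∎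
    where
    open ≡-Reasoning
    ρ′ = setAt ρ i (x i)
    rest = costOn c (loop f c B sel fuel (C ℕ.+ c i) ρ′) x
    free : Free ρ i
    free = selected-free selρ
    C+cᵢ<B : ℕtoℚ (C ℕ.+ c i) < B
    C+cᵢ<B = subst (_< B) (sym (ℕtoℚ-+ C (c i))) (≰⇒> B≰C+cᵢ)
    inv′ : Invariant (C ℕ.+ c i) ρ′
    inv′ = trans (ℕ.+-assoc C (c i) _)
      (trans (cong (C ℕ.+_) (sym (freeWeight-setAt {ρ = ρ} c (x i) free))) inv)
    fuel≥′ : numFree ρ′ ℕ.≤ fuel
    fuel≥′ =
      ℕ.s≤s⁻¹ (subst (ℕ._≤ suc fuel) (freeWeight-setAt {ρ = ρ} (λ _ → 1) (x i) free) fuel≥)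

lemma3 : {n : ℕ} (f : Cube n → PM) (c : Fin n → ℕ) (ε : ℚ) → 0ℚ < ε → ε < ½ →
    (B : ℚ) → 0ℚ < B →
    (sel : Partial n → Maybe (Fin n)) → IsArgmaxSelector f c sel →
    Δ c (Sstar f c ε B sel) ≡ B ⊓ ℕtoℚ (totalCost c)
lemma3 {n} f c ε _ _ B 0<B sel isSel = begin
  𝔼 n (costOn c (Sstar f c ε B sel))  ≡⟨ 𝔼-cong n costOn≡ ⟩
  𝔼 n (λ _ → B ⊓ ℕtoℚ (sum c))        ≡⟨ 𝔼-const n _ ⟩
  B ⊓ ℕtoℚ (sum c)                    ≡⟨ cong (λ t → B ⊓ ℕtoℚ t) (totalCost≡sum c) ⟨
  B ⊓ ℕtoℚ (totalCost c)              ∎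
  where
  open ≡-Reasoning
  costOn≡ : ∀ x → costOn c (Sstar f c ε B sel) x ≡ B ⊓ ℕtoℚ (sum c)
  costOn≡ x = trans (sym (+-identityˡ _))
    (loop-cost f c B sel isSel x n 0 (λ _ → nothing) 0<B refl (ℕ.≤-reflexive (numFree-empty n)))
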